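{- Let $G=(V,E,L)$ be a looped simple graph, $T_1,T_2\subseteq E\cup L$, and $t>1$ an integer. Suppose either (i) for each $j=1,2$, $T_j\cap L\neq\emptyset$ or $|V(T_j)|\geq 2t+2$; or (ii) $|V(T_1)\cap V(T_2)|\geq 1$ and $|V(T_j)|=2t+1$ for each $j=1,2$. Then $f_1(T_1\cup T_2)\leq f_1(T_1)+f_1(T_2)$.
   Context: A looped simple graph $G=(V,E,L)$ has vertex set $V$, simple edges $E$ and loops $L$. For $T\subseteq E\cup L$, $V(T)$ is the set of vertices incident to members of $T$. For an integer $t>1$: $f_1(T)=|T|$ if $T\subseteq E$ and $|V(T)|\leq 2t$; $f_1(T)=t|V(T)|-1$ if $T\subseteq E$ and $|V(T)|=2t+1$; $f_1(T)=t|V(T)|$ if ($T\subseteq E$ and $|V(T)|\geq 2t+2$) or $T\cap L\neq\emptyset$. -}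

module Defs where

open import Data.Bool using (Bool; true; false; _∧_; _∨_; if_then_else_)
open import Data.Nat using (ℕ; zero; suc; _+_; _*_; _∸_; _≤ᵇ_; _<ᵇ_; _≡ᵇ_)
open import Data.Fin using (Fin; toℕ)
import Data.Fin as F
open import Data.Product using (∃)
open import Relation.Binary.PropositionalEquality using (_≡_; refl; cong₂)

-- Sets of vertices / edges are Bool-valued
-- predicates; a set of simple edges is a symmetric, irreflexive predicate
-- on pairs (the unordered pair {i,j} is in the set iff P i j ≡ true).

count : {n : ℕ} → (Fin n → Bool) → ℕ
count {zero}  p = 0
count {suc n} p = (if p F.zero then 1 else 0) + count (λ i → p (F.suc i))

sumF : {n : ℕ} → (Fin n → ℕ) → ℕ
sumF {zero}  f = 0
sumF {suc n} f = f F.zero + sumF (λ i → f (F.suc i))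

anyF : {n : ℕ} → (Fin n → Bool) → Bool
anyF {zero}  p = false
anyF {suc n} p = p F.zero ∨ anyF (λ i → p (F.suc i))

record LoopedGraph (n : ℕ) : Set where
  field
    E        : Fin n → Fin n → Bool
    L        : Fin n → Bool
    E-sym    : ∀ i j → E i j ≡ E j i
    E-irrefl : ∀ i → E i i ≡ false

record EdgeLoopSet (n : ℕ) : Set where
  field
    TE        : Fin n → Fin n → Bool
    TL        : Fin n → Bool
    TE-sym    : ∀ i j → TE i j ≡ TE j i
    TE-irrefl : ∀ i → TE i i ≡ false
open EdgeLoopSet public

_⊆G_ : {n : ℕ} → EdgeLoopSet n → LoopedGraph n → Set
T ⊆G G = (∀ i j → TE T i j ≡ true → LoopedGraph.E G i j ≡ true)
       Data.Product.× (∀ v → TL T v ≡ true → LoopedGraph.L G v ≡ true)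

_∪T_ : {n : ℕ} → EdgeLoopSet n → EdgeLoopSet n → EdgeLoopSet n
T₁ ∪T T₂ = record
  { TE        = λ i j → TE T₁ i j ∨ TE T₂ i j
  ; TL        = λ v → TL T₁ v ∨ TL T₂ v
  ; TE-sym    = λ i j → cong₂ _∨_ (TE-sym T₁ i j) (TE-sym T₂ i j)
  ; TE-irrefl = λ i → cong₂ _∨_ (TE-irrefl T₁ i) (TE-irrefl T₂ i)
  }

-- |T| : number of members (unordered edges {i,j}, i<j, plus loops)
card : {n : ℕ} → EdgeLoopSet n → ℕ
card T = sumF (λ i → count (λ j → (toℕ i <ᵇ toℕ j) ∧ TE T i j)) + count (TL T)

VT : {n : ℕ} → EdgeLoopSet n → Fin n → Bool
VT T v = TL T v ∨ anyF (TE T v)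

nV : {n : ℕ} → EdgeLoopSet n → ℕ
nV T = count (VT T)

hasLoop : {n : ℕ} → EdgeLoopSet n → Bool
hasLoop T = anyF (TL T)

f₁ : {n : ℕ} → ℕ → EdgeLoopSet n → ℕ
f₁ t T =
  if hasLoop T then t * nV T
  else if nV T ≤ᵇ 2 * t then card T
  else if nV T ≡ᵇ suc (2 * t) then t * nV T ∸ 1
  else t * nV T

-- Write m = |V(T₁ ∪ T₂)|.  In case (i) the union again contains a loop or has at
-- least 2t+2 vertices, so f₁ is t times the vertex count on all three sets and
-- the claim is subadditivity of |V(·)|.  In case (ii) f₁(T₁ ∪ T₂) ≤ tm, and by
-- inclusion–exclusion a shared vertex gives m + 1 ≤ |V(T₁)| + |V(T₂)|, so
-- f₁(T₁ ∪ T₂) + t ≤ t|V(T₁)| + t|V(T₂)| ≤ f₁(T₁) + f₁(T₂) + 2; as t ≥ 2, the two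
-- units lost to the "− 1" in f₁ are absorbed.
module Submission where

open import Defs
open import Data.Nat using (ℕ; suc; zero; _*_; _+_; _≤_; _<_; _∸_; _≤ᵇ_; _≡ᵇ_; z≤n; s≤s)
open import Data.Nat.Properties
open import Data.Bool using (Bool; true; false; _∧_; _∨_; if_then_else_)
open import Data.Bool.Properties using (∨-zeroʳ; ∨-commutativeMonoid; ¬-not; T-≡)
open import Algebra.Bundles using (CommutativeMonoid)
open import Algebra.Properties.CommutativeSemigroup
  (CommutativeMonoid.commutativeSemigroup ∨-commutativeMonoid) using (interchange)
open import Data.Fin using (Fin)
import Data.Fin as F
open import Data.Product using (_×_; ∃; _,_)
open import Data.Sum using (_⊎_; inj₁; inj₂)
open import Function using (_∘_)
open import Function.Bundles using (Equivalence)
open import Relation.Binary.PropositionalEquality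

≤ᵇ-false : ∀ {m n} → n < m → (m ≤ᵇ n) ≡ false
≤ᵇ-false {m} {n} n<m = ¬-not λ m≤ᵇn → <⇒≱ n<m (≤ᵇ⇒≤ m n (Equivalence.from T-≡ m≤ᵇn))

≡ᵇ-false : ∀ {m n} → m ≢ n → (m ≡ᵇ n) ≡ false
≡ᵇ-false {m} {n} m≢n = ¬-not λ m≡ᵇn → m≢n (≡ᵇ⇒≡ m n (Equivalence.from T-≡ m≡ᵇn))

≡ᵇ-true : ∀ {m n} → m ≡ n → (m ≡ᵇ n) ≡ true
≡ᵇ-true {m} {n} m≡n = Equivalence.to T-≡ (≡⇒≡ᵇ m n m≡n)

true-or-false : (b : Bool) → b ≡ true ⊎ b ≡ false
true-or-false true  = inj₁ refl
true-or-false false = inj₂ refl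

count-cong : ∀ {n} {p q : Fin n → Bool} → (∀ i → p i ≡ q i) → count p ≡ count q
count-cong {zero}  p≗q = refl
count-cong {suc n} p≗q = cong₂ _+_ (cong (λ b → if b then 1 else 0) (p≗q F.zero))
                                   (count-cong (λ i → p≗q (F.suc i)))

count-∨-+-count-∧ : ∀ {n} (p q : Fin n → Bool) →
  count (λ i → p i ∨ q i) + count (λ i → p i ∧ q i) ≡ count p + count q
count-∨-+-count-∧ {zero}  p q = refl
count-∨-+-count-∧ {suc n} p q
  with p F.zero | q F.zero | count-∨-+-count-∧ (λ i → p (F.suc i)) (λ i → q (F.suc i))
... | false | false | ih = ih
... | true  | false | ih = cong suc ih
... | false | true  | ih = trans (cong suc ih) (sym (+-suc _ _))
... | true  | true  | ih = cong suc (trans (+-suc _ _) (trans (cong suc ih) (sym (+-suc _ _))))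

count-∧-≤ʳ : ∀ {n} (p q : Fin n → Bool) → count (λ i → p i ∧ q i) ≤ count q
count-∧-≤ʳ {zero}  p q = z≤n
count-∧-≤ʳ {suc n} p q with p F.zero | q F.zero
... | false | false = count-∧-≤ʳ (λ i → p (F.suc i)) (λ i → q (F.suc i))
... | false | true  = m≤n⇒m≤1+n (count-∧-≤ʳ (λ i → p (F.suc i)) (λ i → q (F.suc i)))
... | true  | false = count-∧-≤ʳ (λ i → p (F.suc i)) (λ i → q (F.suc i))
... | true  | true  = s≤s (count-∧-≤ʳ (λ i → p (F.suc i)) (λ i → q (F.suc i)))

anyF-∨ : ∀ {n} (p q : Fin n → Bool) → anyF (λ i → p i ∨ q i) ≡ anyF p ∨ anyF q
anyF-∨ {zero}  p q = refl
anyF-∨ {suc n} p q rewrite anyF-∨ (λ i → p (F.suc i)) (λ i → q (F.suc i)) =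
  interchange (p F.zero) (q F.zero) (anyF (λ i → p (F.suc i))) (anyF (λ i → q (F.suc i)))

anyF-witness : ∀ {n} (p : Fin n → Bool) (i : Fin n) → p i ≡ true → anyF p ≡ true
anyF-witness p F.zero    pi≡true rewrite pi≡true = refl
anyF-witness p (F.suc i) pi≡true
  rewrite anyF-witness (λ j → p (F.suc j)) i pi≡true = ∨-zeroʳ (p F.zero)

module _ {n : ℕ} (T₁ T₂ : EdgeLoopSet n) where

  VT-∪ : ∀ v → VT (T₁ ∪T T₂) v ≡ VT T₁ v ∨ VT T₂ v
  VT-∪ v = trans (cong ((TL T₁ v ∨ TL T₂ v) ∨_) (anyF-∨ (TE T₁ v) (TE T₂ v)))
                 (interchange (TL T₁ v) (TL T₂ v) (anyF (TE T₁ v)) (anyF (TE T₂ v)))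

  Shared : ℕ
  Shared = count (λ v → VT T₁ v ∧ VT T₂ v)

  nV-∪-+-shared : nV (T₁ ∪T T₂) + Shared ≡ nV T₁ + nV T₂
  nV-∪-+-shared = trans (cong (_+ Shared) (count-cong VT-∪)) (count-∨-+-count-∧ (VT T₁) (VT T₂))

  nV-∪-≤ : nV (T₁ ∪T T₂) ≤ nV T₁ + nV T₂
  nV-∪-≤ = ≤-trans (m≤m+n _ Shared) (≤-reflexive nV-∪-+-shared)

  nV-≤-∪ˡ : nV T₁ ≤ nV (T₁ ∪T T₂)
  nV-≤-∪ˡ = +-cancelʳ-≤ (nV T₂) _ _ (begin
    nV T₁ + nV T₂              ≡⟨ nV-∪-+-shared ⟨
    nV (T₁ ∪T T₂) + Shared     ≤⟨ +-monoʳ-≤ _ (count-∧-≤ʳ (VT T₁) (VT T₂)) ⟩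
    nV (T₁ ∪T T₂) + nV T₂      ∎)
    where open ≤-Reasoning

  nV-∪-< : 1 ≤ Shared → suc (nV (T₁ ∪T T₂)) ≤ nV T₁ + nV T₂
  nV-∪-< shared = begin
    suc (nV (T₁ ∪T T₂))        ≡⟨ +-comm 1 _ ⟩
    nV (T₁ ∪T T₂) + 1          ≤⟨ +-monoʳ-≤ _ shared ⟩
    nV (T₁ ∪T T₂) + Shared     ≡⟨ nV-∪-+-shared ⟩
    nV T₁ + nV T₂              ∎
    where open ≤-Reasoning

Large : ∀ {n} → ℕ → EdgeLoopSet n → Set
Large t T = (∃ λ v → TL T v ≡ true) ⊎ suc (suc (2 * t)) ≤ nV T

Large-∪ˡ : ∀ {n} t (T₁ T₂ : EdgeLoopSet n) → Large t T₁ → Large t (T₁ ∪T T₂)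
Large-∪ˡ _ T₁ T₂ (inj₁ (v , loop)) = inj₁ (v , cong (_∨ TL T₂ v) loop)
Large-∪ˡ _ T₁ T₂ (inj₂ big)        = inj₂ (≤-trans big (nV-≤-∪ˡ T₁ T₂))

module _ {n : ℕ} (t : ℕ) (X : EdgeLoopSet n) where

  f₁-loop : hasLoop X ≡ true → f₁ t X ≡ t * nV X
  f₁-loop loop rewrite loop = refl

  f₁-loopless-large : hasLoop X ≡ false → suc (suc (2 * t)) ≤ nV X → f₁ t X ≡ t * nV X
  f₁-loopless-large noLoop big
    rewrite noLoop | ≤ᵇ-false (≤-trans (n≤1+n _) big) | ≡ᵇ-false (<⇒≢ big ∘ sym) = refl

  f₁-loopless-critical : hasLoop X ≡ false → nV X ≡ suc (2 * t) → f₁ t X ≡ t * nV X ∸ 1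
  f₁-loopless-critical noLoop critical
    rewrite noLoop | ≤ᵇ-false (≤-reflexive (sym critical)) | ≡ᵇ-true critical = refl

  f₁-large : Large t X → f₁ t X ≡ t * nV X
  f₁-large (inj₁ (v , loop)) = f₁-loop (anyF-witness (TL X) v loop)
  f₁-large (inj₂ big) with true-or-false (hasLoop X)
  ... | inj₁ loop   = f₁-loop loop
  ... | inj₂ noLoop = f₁-loopless-large noLoop big

  f₁-≤ : 2 * t < nV X → f₁ t X ≤ t * nV X
  f₁-≤ beyond with true-or-false (hasLoop X) | m≤n⇒m<n∨m≡n beyond
  ... | inj₁ loop   | _             = ≤-reflexive (f₁-loop loop)
  ... | inj₂ noLoop | inj₁ big      = ≤-reflexive (f₁-loopless-large noLoop big)
  ... | inj₂ noLoop | inj₂ critical =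
    ≤-trans (≤-reflexive (f₁-loopless-critical noLoop (sym critical))) (m∸n≤m _ 1)

  f₁-critical-≥ : nV X ≡ suc (2 * t) → t * nV X ≤ suc (f₁ t X)
  f₁-critical-≥ critical with true-or-false (hasLoop X)
  ... | inj₁ loop   = m≤n⇒m≤1+n (≤-reflexive (sym (f₁-loop loop)))
  ... | inj₂ noLoop = subst (λ f → t * nV X ≤ suc f) (sym (f₁-loopless-critical noLoop critical))
                            (m≤n+m∸n _ 1)

module _ {n : ℕ} (t : ℕ) (T₁ T₂ : EdgeLoopSet n) where

  f₁-∪-large : Large t T₁ → Large t T₂ → f₁ t (T₁ ∪T T₂) ≤ f₁ t T₁ + f₁ t T₂
  f₁-∪-large large₁ large₂ = begin
    f₁ t (T₁ ∪T T₂)          ≡⟨ f₁-large t (T₁ ∪T T₂) (Large-∪ˡ t T₁ T₂ large₁) ⟩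
    t * nV (T₁ ∪T T₂)        ≤⟨ *-monoʳ-≤ t (nV-∪-≤ T₁ T₂) ⟩
    t * (nV T₁ + nV T₂)      ≡⟨ *-distribˡ-+ t (nV T₁) (nV T₂) ⟩
    t * nV T₁ + t * nV T₂    ≡⟨ cong₂ _+_ (f₁-large t T₁ large₁) (f₁-large t T₂ large₂) ⟨
    f₁ t T₁ + f₁ t T₂        ∎
    where open ≤-Reasoning

  f₁-∪-critical : 1 < t → 1 ≤ Shared T₁ T₂ →
    nV T₁ ≡ suc (2 * t) → nV T₂ ≡ suc (2 * t) → f₁ t (T₁ ∪T T₂) ≤ f₁ t T₁ + f₁ t T₂
  f₁-∪-critical t≥2 shared critical₁ critical₂ = +-cancelʳ-≤ 2 _ _ (begin
    f₁ t (T₁ ∪T T₂) + 2       ≤⟨ +-monoˡ-≤ 2 (f₁-≤ t (T₁ ∪T T₂) beyond) ⟩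
    t * m + 2                 ≤⟨ +-monoʳ-≤ (t * m) t≥2 ⟩
    t * m + t                 ≡⟨ +-comm (t * m) t ⟩
    t + t * m                 ≡⟨ *-suc t m ⟨
    t * suc m                 ≤⟨ *-monoʳ-≤ t (nV-∪-< T₁ T₂ shared) ⟩
    t * (nV T₁ + nV T₂)       ≡⟨ *-distribˡ-+ t (nV T₁) (nV T₂) ⟩
    t * nV T₁ + t * nV T₂     ≤⟨ +-mono-≤ (f₁-critical-≥ t T₁ critical₁) (f₁-critical-≥ t T₂ critical₂) ⟩
    suc (f₁ t T₁) + suc (f₁ t T₂) ≡⟨ cong suc (+-suc (f₁ t T₁) (f₁ t T₂)) ⟩
    2 + (f₁ t T₁ + f₁ t T₂)   ≡⟨ +-comm 2 _ ⟩
    f₁ t T₁ + f₁ t T₂ + 2     ∎)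
    where
    open ≤-Reasoning
    m : ℕ
    m = nV (T₁ ∪T T₂)
    beyond : 2 * t < m
    beyond = ≤-trans (≤-reflexive (sym critical₁)) (nV-≤-∪ˡ T₁ T₂)

lemma3p8 : {n : ℕ} (G : LoopedGraph n) (T₁ T₂ : EdgeLoopSet n) (t : ℕ) →
    1 < t → T₁ ⊆G G → T₂ ⊆G G →
    ( ((∃ λ v → TL T₁ v ≡ true) ⊎ suc (suc (2 * t)) ≤ nV T₁)
      × ((∃ λ v → TL T₂ v ≡ true) ⊎ suc (suc (2 * t)) ≤ nV T₂) )
    ⊎ ( (1 ≤ count (λ v → VT T₁ v ∧ VT T₂ v))
      × (nV T₁ ≡ suc (2 * t)) × (nV T₂ ≡ suc (2 * t)) ) →
    f₁ t (T₁ ∪T T₂) ≤ f₁ t T₁ + f₁ t T₂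
lemma3p8 G T₁ T₂ t _   _ _ (inj₁ (large₁ , large₂)) = f₁-∪-large t T₁ T₂ large₁ large₂
lemma3p8 G T₁ T₂ t t≥2 _ _ (inj₂ (shared , critical₁ , critical₂)) =
  f₁-∪-critical t T₁ T₂ t≥2 shared critical₁ critical₂
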